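{- There is a set $\Gamma$ of relations on $\{0,1\}$ such that $\langle\Gamma\rangle_{\max}\ne\langle\Gamma\rangle^1_{\max}$.
   Context: Max-implementation: for an $(n+m)$-ary relation $R$ on $\{0,1\}$, $\exists_{\max}(y_1,\dots,y_m)R(x_1,\dots,x_n,y_1,\dots,y_m)$ consists of those $\mathbf a\in\{0,1\}^n$ whose number of extensions $\mathbf b\in\{0,1\}^m$ with $(\mathbf a,\mathbf b)\in R$ is maximal over all $\mathbf a\in\{0,1\}^n$; the max-quantifier $\exists^1_{\max}$ is the special case $m=1$ (a single variable). $\langle\Gamma\rangle_{\max}$ (resp. $\langle\Gamma\rangle^1_{\max}$) is the smallest set of relations on $\{0,1\}$ containing $\Gamma$ and $\mathrm{EQ}=\{(0,0),(1,1)\}$ and closed under manipulations with variables (renaming, permuting, identifying variables), conjunction, and max-implementation (resp. max-quantification over a single variable). -}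

module Defs where

open import Data.Nat using (ℕ; zero; suc; _+_; _⊔_; _≡ᵇ_)
open import Data.Bool using (Bool; true; false; if_then_else_; not; _∧_)
open import Data.Fin using (Fin; zero; suc)
open import Data.Vec.Functional using (Vector; _∷_; _++_)
open import Data.Product using (_×_)
open import Data.Unit using (⊤)
open import Relation.Binary.PropositionalEquality using (_≡_)

Tuple : ℕ → Set
Tuple n = Fin n → Bool

Rel : ℕ → Set
Rel n = Tuple n → Bool

RelSet : Set₁
RelSet = (n : ℕ) → Rel n → Set

count : (m : ℕ) → (Tuple m → Bool) → ℕ
count zero    P = if P (λ ()) then 1 else 0
count (suc m) P = count m (λ b → P (false ∷ b)) + count m (λ b → P (true ∷ b))

maxOver : (n : ℕ) → (Tuple n → ℕ) → ℕ
maxOver zero    f = f (λ ())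
maxOver (suc n) f = maxOver n (λ a → f (false ∷ a)) ⊔ maxOver n (λ a → f (true ∷ a))

extensions : (n m : ℕ) → Rel (n + m) → Tuple n → ℕ
extensions n m R a = count m (λ b → R (a ++ b))

maxImpl : (n m : ℕ) → Rel (n + m) → Rel n
maxImpl n m R a = extensions n m R a ≡ᵇ maxOver n (extensions n m R)

EQ : Rel 2
EQ x = if x zero then x (suc zero) else not (x (suc zero))

-- Closure of Γ ∪ {EQ} under manipulations of variables (substitution
-- x ↦ x ∘ σ for an arbitrary map of variables σ : Fin n → Fin k, covering
-- renaming, permuting and identifying variables), conjunction, and
-- max-implementation over m variables for every m satisfying `Allowed m`.
-- Relations are sets, so membership is closed under extensional equality.
data Closure (Allowed : ℕ → Set) (Γ : RelSet) : RelSet where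
  base  : ∀ {n} {R : Rel n} → Γ n R → Closure Allowed Γ n R
  eq    : Closure Allowed Γ 2 EQ
  subst : ∀ {n k} {R : Rel n} (σ : Fin n → Fin k) →
          Closure Allowed Γ n R → Closure Allowed Γ k (λ x → R (λ i → x (σ i)))
  conj  : ∀ {n} {R S : Rel n} → Closure Allowed Γ n R → Closure Allowed Γ n S →
          Closure Allowed Γ n (λ x → R x ∧ S x)
  maxq  : ∀ {n m} {R : Rel (n + m)} → Allowed m →
          Closure Allowed Γ (n + m) R → Closure Allowed Γ n (maxImpl n m R)
  ext   : ∀ {n} {R S : Rel n} → Closure Allowed Γ n R → (∀ x → R x ≡ S x) →
          Closure Allowed Γ n S

⟨_⟩max : RelSet → RelSet
⟨ Γ ⟩max = Closure (λ _ → ⊤) Γ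

⟨_⟩¹max : RelSet → RelSet
⟨ Γ ⟩¹max = Closure (λ m → m ≡ 1) Γ

SameRels : RelSet → RelSet → Set
SameRels C D = (n : ℕ) (R : Rel n) → (C n R → D n R) × (D n R → C n R)

module Submission where

-- The separating set is Γ₀ = {R₀} with the Horn relation
--   R₀(x₁,x₂,y₁,y₂) = ¬(x₁ ∧ x₂) ∧ (y₁ → x₂) ∧ (y₂ → x₁).
-- The invariant is closure under the coordinatewise meet ∧ (the min
-- polymorphism).  EQ, R₀ and every relation obtained from ∧-closed relations
-- by substitution of variables or conjunction are ∧-closed.  The key fact is
-- that max-quantification over ONE variable also preserves ∧-closedness: for a
-- single quantified variable the number of extensions of a ∧ a' is at least
-- the minimum of the numbers of extensions of a and of a' (a finite check on
-- the two fibres).  Hence every relation of ⟨Γ₀⟩¹max is ∧-closed.  On the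
-- other hand ∃max(y₁,y₂) R₀ = {01, 10} lies in ⟨Γ₀⟩max and is not ∧-closed,
-- since 01 ∧ 10 = 00.

open import Defs
open import Data.Bool using (Bool; true; false; T; not; _∧_; _∨_; if_then_else_)
open import Data.Bool.Properties using (T-∧; ∧-idem)
open import Data.Empty using (⊥-elim)
open import Data.Fin using (Fin; zero; suc; splitAt)
open import Data.Fin.Patterns using (0F; 1F; 2F; 3F)
open import Data.Nat using (ℕ; zero; suc; _+_; _⊓_; _≤_; z≤n; s≤s)
open import Data.Nat.Properties
  using (≡ᵇ⇒≡; ≡⇒≡ᵇ; ≤-antisym; ≤-trans; ≤-reflexive; m≤m⊔n; m≤n⊔m; ⊓-idem; module ≤-Reasoning)
open import Data.Product using (Σ; _,_; proj₁)
open import Data.Sum using (inj₁; inj₂)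
open import Data.Unit using (tt)
open import Data.Vec.Functional using (_∷_; _++_; tail)
open import Data.Vec.Functional.Properties using (++-cong)
open import Function using (Equivalence)
open import Relation.Binary.PropositionalEquality using (_≡_; refl; sym; trans; cong; cong₂; _≗_)
open import Relation.Nullary using (¬_)

IsMeet : ∀ {n} → Tuple n → Tuple n → Tuple n → Set
IsMeet x y z = ∀ i → z i ≡ x i ∧ y i

-- Quantifying over all z equal to
-- the meet (rather than one fixed function) makes the notion invariant under
-- pointwise equality of tuples, see `respects`.
Preserves∧ : ∀ {n} → Rel n → Set
Preserves∧ {n} R = ∀ (x y z : Tuple n) → IsMeet x y z → T (R x) → T (R y) → T (R z)

T-ext : ∀ {a b} → (T a → T b) → (T b → T a) → a ≡ b
T-ext {false} {false} _ _ = refl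
T-ext {false} {true}  _ g = ⊥-elim (g tt)
T-ext {true}  {false} f _ = ⊥-elim (f tt)
T-ext {true}  {true}  _ _ = refl

-- An ∧-closed relation cannot distinguish pointwise equal tuples, since each
-- of two pointwise equal tuples is the meet of the other with itself.
respects : ∀ {n} {R : Rel n} → Preserves∧ R → ∀ {x y} → x ≗ y → R x ≡ R y
respects pR {x} {y} x≗y =
  T-ext (λ p → pR x x y (self-meet x≗y) p p) (λ p → pR y y x (self-meet (λ i → sym (x≗y i))) p p)
  where
  self-meet : ∀ {u v : Tuple _} → u ≗ v → IsMeet u u v
  self-meet {u} u≗v i = trans (sym (u≗v i)) (sym (∧-idem (u i)))

subst-preserves : ∀ {n k} {R : Rel n} (σ : Fin n → Fin k) →
                  Preserves∧ R → Preserves∧ (λ x → R (λ i → x (σ i)))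
subst-preserves σ pR x y z m = pR _ _ _ (λ i → m (σ i))

conj-preserves : ∀ {n} {R S : Rel n} → Preserves∧ R → Preserves∧ S →
                 Preserves∧ (λ x → R x ∧ S x)
conj-preserves pR pS x y z m p q =
  let (pR₁ , pS₁) = Equivalence.to T-∧ p
      (pR₂ , pS₂) = Equivalence.to T-∧ q
  in Equivalence.from T-∧ (pR x y z m pR₁ pR₂ , pS x y z m pS₁ pS₂)

ext-preserves : ∀ {n} {R S : Rel n} → (∀ x → R x ≡ S x) → Preserves∧ R → Preserves∧ S
ext-preserves R≡S pR x y z m p q =
  cast (R≡S z) (pR x y z m (cast (sym (R≡S x)) p) (cast (sym (R≡S y)) q))
  where
  cast : ∀ {a b} → a ≡ b → T a → T b
  cast refl t = t

binary-preserves : ∀ {n} (f : Bool → Bool → Bool) →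
                   (∀ a b c d → T (f a b) → T (f c d) → T (f (a ∧ c) (b ∧ d))) →
                   (i j : Fin n) → Preserves∧ (λ x → f (x i) (x j))
binary-preserves f f-meet i j x y z m p q rewrite m i | m j = f-meet (x i) (x j) (y i) (y j) p q

eqᵇ : Bool → Bool → Bool
eqᵇ a b = if a then b else not b

eqᵇ-sound : ∀ {a b} → T (eqᵇ a b) → a ≡ b
eqᵇ-sound {false} {false} _ = refl
eqᵇ-sound {true}  {true}  _ = refl

eqᵇ-refl : ∀ a → T (eqᵇ a a)
eqᵇ-refl false = tt
eqᵇ-refl true  = tt

eqᵇ-meet : ∀ a b c d → T (eqᵇ a b) → T (eqᵇ c d) → T (eqᵇ (a ∧ c) (b ∧ d))
eqᵇ-meet a b c d p q rewrite eqᵇ-sound {a} {b} p | eqᵇ-sound {c} {d} q = eqᵇ-refl (b ∧ d)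

nand : Bool → Bool → Bool
nand a b = not (a ∧ b)

nand-meet : ∀ a b c d → T (nand a b) → T (nand c d) → T (nand (a ∧ c) (b ∧ d))
nand-meet false b     c     d _ _ = tt
nand-meet true  false false d _ _ = tt
nand-meet true  false true  d _ _ = tt
nand-meet true  true  c     d () _

implies : Bool → Bool → Bool
implies a b = not a ∨ b

implies-meet : ∀ a b c d → T (implies a b) → T (implies c d) → T (implies (a ∧ c) (b ∧ d))
implies-meet false b     c     d     _ _  = tt
implies-meet true  false c     d     () _
implies-meet true  true  false d     _ _  = tt
implies-meet true  true  true  false _ ()
implies-meet true  true  true  true  _ _  = tt

EQ-preserves : Preserves∧ EQ
EQ-preserves = binary-preserves eqᵇ eqᵇ-meet 0F 1F

ind : Bool → ℕ
ind b = if b then 1 else 0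

count₁ : (Bool → Bool) → ℕ
count₁ P = ind (P false) + ind (P true)

count₁-meet : (P Q S : Bool → Bool) →
              (∀ b c → T (P b) → T (Q c) → T (S (b ∧ c))) →
              count₁ P ⊓ count₁ Q ≤ count₁ S
count₁-meet P Q S h =
  table (P false) (P true) (Q false) (Q true)
        (h false false) (h false true) (h true false) (h true true)
  where
  one₀ : ∀ {r₀ r₁} → T r₀ → 1 ≤ ind r₀ + ind r₁
  one₀ {true} _ = s≤s z≤n

  one₁ : ∀ {r₀ r₁} → T r₁ → 1 ≤ ind r₀ + ind r₁
  one₁ {false} {true} _ = s≤s z≤n
  one₁ {true}  {true} _ = s≤s z≤n

  two : ∀ {r₀ r₁} → T r₀ → T r₁ → 2 ≤ ind r₀ + ind r₁
  two {true} {true} _ _ = s≤s (s≤s z≤n)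

  table : ∀ p₀ p₁ q₀ q₁ →
          (T p₀ → T q₀ → T (S false)) → (T p₀ → T q₁ → T (S false)) →
          (T p₁ → T q₀ → T (S false)) → (T p₁ → T q₁ → T (S true)) →
          (ind p₀ + ind p₁) ⊓ (ind q₀ + ind q₁) ≤ count₁ S
  table false false _     _     _   _   _   _   = z≤n
  table true  false false false _   _   _   _   = z≤n
  table false true  false false _   _   _   _   = z≤n
  table true  true  false false _   _   _   _   = z≤n
  table true  false true  false h₀₀ _   _   _   = one₀ (h₀₀ tt tt)
  table true  false false true  _   h₀₁ _   _   = one₀ (h₀₁ tt tt)
  table true  false true  true  h₀₀ _   _   _   = one₀ (h₀₀ tt tt)
  table false true  true  false _   _   h₁₀ _   = one₀ (h₁₀ tt tt)
  table false true  false true  _   _   _   h₁₁ = one₁ (h₁₁ tt tt)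
  table false true  true  true  _   _   _   h₁₁ = one₁ (h₁₁ tt tt)
  table true  true  true  false h₀₀ _   _   _   = one₀ (h₀₀ tt tt)
  table true  true  false true  _   _   _   h₁₁ = one₁ (h₁₁ tt tt)
  table true  true  true  true  h₀₀ _   _   h₁₁ = two (h₀₀ tt tt) (h₁₁ tt tt)

bit : Bool → Tuple 1
bit b = b ∷ (λ ())

bit-meet : ∀ b c → IsMeet (bit b) (bit c) (bit (b ∧ c))
bit-meet b c zero = refl

++-meet : ∀ {n m} {a a' z : Tuple n} {u v w : Tuple m} →
          IsMeet a a' z → IsMeet u v w → IsMeet (a ++ u) (a' ++ v) (z ++ w)
++-meet {n} aa'z uvw i with splitAt n i
... | inj₁ j = aa'z j
... | inj₂ j = uvw j

extensions-meet : ∀ n {R : Rel (n + 1)} → Preserves∧ R →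
                  ∀ {a a' z} → IsMeet a a' z →
                  extensions n 1 R a ⊓ extensions n 1 R a' ≤ extensions n 1 R z
extensions-meet n {R} pR {a} {a'} {z} m =
  count₁-meet (fibre a) (fibre a') (fibre z) (λ b c → pR _ _ _ (++-meet m (bit-meet b c)))
  where
  fibre : Tuple n → Bool → Bool
  fibre x b = R (x ++ bit b)

maxOver-upper : ∀ n (f : Tuple n → ℕ) → (∀ {a a'} → a ≗ a' → f a ≡ f a') →
                ∀ a → f a ≤ maxOver n f
maxOver-upper zero    f f-resp a = ≤-reflexive (f-resp (λ ()))
maxOver-upper (suc n) f f-resp a = begin
  f a                  ≡⟨ f-resp head∷tail ⟩
  f (a zero ∷ tail a)  ≤⟨ branch (a zero) ⟩
  maxOver (suc n) f    ∎
  where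
  open ≤-Reasoning
  head∷tail : a ≗ (a zero ∷ tail a)
  head∷tail zero    = refl
  head∷tail (suc i) = refl

  fix : ∀ b → Tuple n → ℕ
  fix b t = f (b ∷ t)

  fix-resp : ∀ b {t t'} → t ≗ t' → fix b t ≡ fix b t'
  fix-resp b t≗t' = f-resp λ { zero → refl ; (suc i) → t≗t' i }

  branch : ∀ b → fix b (tail a) ≤ maxOver (suc n) f
  branch false = ≤-trans (maxOver-upper n (fix false) (fix-resp false) (tail a)) (m≤m⊔n _ _)
  branch true  = ≤-trans (maxOver-upper n (fix true)  (fix-resp true)  (tail a)) (m≤n⊔m _ _)

-- Max-quantification over a single variable preserves ∧-closedness: if a and
-- a' both attain the maximum M, then M = min(#ext a, #ext a') ≤ #ext (a ∧ a')
-- ≤ M, so a ∧ a' attains it as well.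
max₁-preserves : ∀ n {R : Rel (n + 1)} → Preserves∧ R → Preserves∧ (maxImpl n 1 R)
max₁-preserves n {R} pR a a' z m a-max a'-max =
  ≡⇒≡ᵇ (exts z) M (≤-antisym (maxOver-upper n exts exts-resp z) M≤exts-z)
  where
  open ≤-Reasoning
  exts : Tuple n → ℕ
  exts = extensions n 1 R

  M : ℕ
  M = maxOver n exts

  exts-resp : ∀ {x x'} → x ≗ x' → exts x ≡ exts x'
  exts-resp x≗x' = cong₂ _+_ (cong ind (respects pR (++-cong _ _ x≗x' (λ _ → refl))))
                            (cong ind (respects pR (++-cong _ _ x≗x' (λ _ → refl))))

  M≤exts-z : M ≤ exts z
  M≤exts-z = begin
    M                ≡⟨ sym (⊓-idem M) ⟩
    M ⊓ M            ≡⟨ sym (cong₂ _⊓_ (≡ᵇ⇒≡ (exts a) M a-max) (≡ᵇ⇒≡ (exts a') M a'-max)) ⟩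
    exts a ⊓ exts a' ≤⟨ extensions-meet n pR m ⟩
    exts z           ∎

single-max-preserves : ∀ {Γ} → (∀ {n R} → Γ n R → Preserves∧ R) →
                       ∀ {n R} → ⟨ Γ ⟩¹max n R → Preserves∧ R
single-max-preserves pΓ (base g)          = pΓ g
single-max-preserves pΓ eq                = EQ-preserves
single-max-preserves pΓ (subst σ c)       = subst-preserves σ (single-max-preserves pΓ c)
single-max-preserves pΓ (conj c d)        =
  conj-preserves (single-max-preserves pΓ c) (single-max-preserves pΓ d)
single-max-preserves pΓ (maxq {n} refl c) = max₁-preserves n (single-max-preserves pΓ c)
single-max-preserves pΓ (ext c R≡S)       = ext-preserves R≡S (single-max-preserves pΓ c)

R₀ : Rel 4
R₀ x = nand (x 0F) (x 1F) ∧ (implies (x 2F) (x 1F) ∧ implies (x 3F) (x 0F))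

data Γ₀ : RelSet where
  r₀ : Γ₀ 4 R₀

R₀-preserves : Preserves∧ R₀
R₀-preserves =
  conj-preserves (binary-preserves nand nand-meet 0F 1F)
    (conj-preserves (binary-preserves implies implies-meet 2F 1F)
                    (binary-preserves implies implies-meet 3F 0F))

Γ₀-preserves : ∀ {n R} → Γ₀ n R → Preserves∧ R
Γ₀-preserves r₀ = R₀-preserves

-- ∃max(y₁,y₂) R₀(x₁,x₂,y₁,y₂) = {01, 10}: the tuples 01 and 10 have two
-- extensions each, 00 only one.  It is not ∧-closed, since 01 ∧ 10 = 00.
R₀-max : Rel 2
R₀-max = maxImpl 2 2 R₀

R₀-max-not-preserves : ¬ Preserves∧ R₀-max
R₀-max-not-preserves p∧ = p∧ (false ∷ true ∷ (λ ())) (true ∷ false ∷ (λ ())) (false ∷ false ∷ (λ ()))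
                             (λ { zero → refl ; (suc zero) → refl }) tt tt

corollary35 : Σ RelSet (λ Γ → ¬ SameRels ⟨ Γ ⟩max ⟨ Γ ⟩¹max)
corollary35 = Γ₀ , λ same →
  let R₀-max∈⟨Γ₀⟩max  = maxq tt (base r₀)
      R₀-max∈⟨Γ₀⟩¹max = proj₁ (same 2 R₀-max) R₀-max∈⟨Γ₀⟩max
  in R₀-max-not-preserves (single-max-preserves Γ₀-preserves R₀-max∈⟨Γ₀⟩¹max)
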